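{- Let $P:\{0,1\}^k\to\{0,1\}$ be a random predicate with $|P^{ -1}(1)|=t$, i.e., $P^{ -1}(1)$ is a uniformly random $t$-element subset of $\{0,1\}^k$. Then with probability at least $1-t^4/2^k$, $P^{ -1}(1)$ does not contain any affine subspace of $\mathbb{F}_2^k$ of dimension $2$.
   Context: $\{0,1\}^k$ is identified with the vector space $\mathbb{F}_2^k$. -}

module Defs where

open import Data.Bool using (Bool; true; false; _xor_; _∧_; not; if_then_else_)
open import Data.Nat using (ℕ; zero; suc)
open import Data.Vec using (Vec; []; _∷_; zipWith; replicate)
open import Data.List using (List; []; _∷_; map; concatMap; filterᵇ; length)
open import Data.Bool.ListAction using (any)
open import Data.Vec.Properties using (≡-dec)
import Data.Bool.Properties as BP
open import Relation.Nullary.Decidable using (⌊_⌋)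

Point : ℕ → Set
Point k = Vec Bool k

_⊕_ : ∀ {k} → Point k → Point k → Point k
_⊕_ = zipWith _xor_

zeroV : ∀ {k} → Point k
zeroV = replicate _ false

_==_ : ∀ {k} → Point k → Point k → Bool
u == v = ⌊ ≡-dec BP._≟_ u v ⌋

allPoints : (k : ℕ) → List (Point k)
allPoints zero = [] ∷ []
allPoints (suc k) = map (false ∷_) (allPoints k) Data.List.++ map (true ∷_) (allPoints k)

Pred : ℕ → Set
Pred k = Point k → Bool

combine : ∀ {k} → Pred k → Pred k → Pred (suc k)
combine p q (false ∷ v) = p v
combine p q (true ∷ v) = q v

-- All 2^(2^k) predicates on {0,1}^k (each exactly once, up to pointwise equality)
allPreds : (k : ℕ) → List (Pred k)
allPreds zero = (λ _ → false) ∷ (λ _ → true) ∷ []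
allPreds (suc k) = concatMap (λ p → map (combine p) (allPreds k)) (allPreds k)

weight : ∀ {k} → Pred k → ℕ
weight {k} P = length (filterᵇ P (allPoints k))

-- A 2-dimensional affine subspace of F₂^k is a coset a + span{u,v} with u,v
-- linearly independent over F₂ (u ≠ 0, v ≠ 0, u ≠ v), i.e. the set
-- {a, a+u, a+v, a+u+v}.  P⁻¹(1) contains such a set:
containsAffinePlane : ∀ {k} → Pred k → Bool
containsAffinePlane {k} P =
  any (λ a → any (λ u → any (λ v →
        not (u == zeroV) ∧ not (v == zeroV) ∧ not (u == v)
        ∧ P a ∧ P (a ⊕ u) ∧ P (a ⊕ v) ∧ P ((a ⊕ u) ⊕ v))
      (allPoints k)) (allPoints k)) (allPoints k)

-- The sample space: predicates with |P⁻¹(1)| = t (uniform distribution over it)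
predsOfWeight : (k t : ℕ) → List (Pred k)
predsOfWeight k t = filterᵇ (λ P → ⌊ Data.Nat._≟_ (weight P) t ⌋) (allPreds k)

badPreds : (k t : ℕ) → List (Pred k)
badPreds k t = filterᵇ containsAffinePlane (predsOfWeight k t)

-- Double counting.  Pair each bad predicate P with an arbitrary point x; there are
-- |bad| · 2^k such pairs.  Choose an affine plane {a, a+u, a+v, d} inside P⁻¹(1) and, if
-- P(x) = 0, exchange x for d; this keeps the weight t.  The resulting Q, together with the
-- four points (a, a+u, a+v, x) of Q⁻¹(1), determines (P, x): d = a + (a+u) + (a+v), and x was
-- exchanged in exactly when Q(d) = 0.  There are at most |predsOfWeight| · t^4 such data.

module Submission where

open import Defs
open import Data.Nat using (ℕ; _*_; _^_; _≤_)
open import Data.List using (length)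

open import Data.Bool as Bool using (Bool; true; false; _∧_; not; if_then_else_; T; T?)
open import Data.Bool.Properties
  using (T-≡; T-not-≡; T-∧; xor-assoc; xor-comm; xor-identityˡ; xor-identityʳ; xor-same)
open import Data.List using (List; []; _∷_; _++_; map; concatMap; filterᵇ; cartesianProduct)
open import Data.List.Properties using (length-++; length-map; filter-≐)
open import Data.List.Relation.Unary.All as All using (All; []; _∷_)
open import Data.List.Relation.Unary.Any as Any using (Any; here; there)
open import Data.List.Relation.Unary.Any.Properties using (any⁻)
open import Data.Nat as ℕ using (zero; suc; _+_; z≤n; s≤s)
open import Data.Nat.Properties hiding (_≟_)
open import Data.Product using (_×_; _,_; proj₁; proj₂)
open import Data.List.Membership.Propositional using (_∈_; find; lose)
open import Data.List.Membership.Propositional.Properties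
  using (∈-map⁺; ∈-concatMap⁺; ∈-filter⁺; ∈-filter⁻; ∈-cartesianProduct⁺; ∈-cartesianProduct⁻)
open import Data.List.Relation.Unary.All.Properties using (all-filter)
open import Data.Vec using ([]; _∷_)
open import Data.Vec.Properties
  using (zipWith-assoc; zipWith-comm; zipWith-identityˡ; zipWith-identityʳ; ≡-dec)
open import Function using (_∘_)
open import Function.Bundles using (Equivalence)
open import Relation.Binary.PropositionalEquality
open import Relation.Binary.Definitions using (DecidableEquality)
open import Relation.Nullary using (yes; no)
open import Relation.Nullary.Decidable
  using (⌊_⌋; isYes≗does; toWitness; toWitnessFalse; fromWitness; fromWitnessFalse)

open import Algebra.Properties.CommutativeSemigroup +-commutativeSemigroup
  using () renaming (interchange to +-interchange)

private
  variable
    A B : Set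

𝟙 : Bool → ℕ
𝟙 true = 1
𝟙 false = 0

∑ : List A → (A → ℕ) → ℕ
∑ [] f = 0
∑ (x ∷ xs) f = f x + ∑ xs f

syntax ∑ xs (λ x → e) = ∑[ x ∈ xs ] e

∑-++ : ∀ (xs ys : List A) f → ∑ (xs ++ ys) f ≡ ∑ xs f + ∑ ys f
∑-++ [] ys f = refl
∑-++ (x ∷ xs) ys f = trans (cong (f x +_) (∑-++ xs ys f)) (sym (+-assoc (f x) _ _))

∑-map : ∀ (g : A → B) xs f → ∑ (map g xs) f ≡ ∑ xs (f ∘ g)
∑-map g [] f = refl
∑-map g (x ∷ xs) f = cong (f (g x) +_) (∑-map g xs f)

∑-concatMap : ∀ (g : A → List B) xs f → ∑ (concatMap g xs) f ≡ ∑[ x ∈ xs ] ∑ (g x) f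
∑-concatMap g [] f = refl
∑-concatMap g (x ∷ xs) f = trans (∑-++ (g x) _ f) (cong (∑ (g x) f +_) (∑-concatMap g xs f))

∑-cartesianProduct : ∀ (xs : List A) (ys : List B) f →
  ∑ (cartesianProduct xs ys) f ≡ ∑[ x ∈ xs ] ∑[ y ∈ ys ] f (x , y)
∑-cartesianProduct [] ys f = refl
∑-cartesianProduct (x ∷ xs) ys f =
  trans (∑-++ (map (x ,_) ys) _ f) (cong₂ _+_ (∑-map (x ,_) ys f) (∑-cartesianProduct xs ys f))

∑-cong : ∀ xs {f g : A → ℕ} → (∀ x → f x ≡ g x) → ∑ xs f ≡ ∑ xs g
∑-cong [] h = refl
∑-cong (x ∷ xs) h = cong₂ _+_ (h x) (∑-cong xs h)

∑-congᴬ : ∀ {xs} {f g : A → ℕ} → All (λ x → f x ≡ g x) xs → ∑ xs f ≡ ∑ xs g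
∑-congᴬ [] = refl
∑-congᴬ (e ∷ es) = cong₂ _+_ e (∑-congᴬ es)

∑-mono : ∀ xs {f g : A → ℕ} → (∀ x → f x ≤ g x) → ∑ xs f ≤ ∑ xs g
∑-mono [] h = z≤n
∑-mono (x ∷ xs) h = +-mono-≤ (h x) (∑-mono xs h)

∑-monoᴬ : ∀ {xs} {f g : A → ℕ} → All (λ x → f x ≤ g x) xs → ∑ xs f ≤ ∑ xs g
∑-monoᴬ [] = z≤n
∑-monoᴬ (le ∷ les) = +-mono-≤ le (∑-monoᴬ les)

∑-const : ∀ (xs : List A) c → ∑[ x ∈ xs ] c ≡ length xs * c
∑-const [] c = refl
∑-const (x ∷ xs) c = cong (c +_) (∑-const xs c)

∑-zero : ∀ (xs : List A) → ∑[ x ∈ xs ] 0 ≡ 0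
∑-zero [] = refl
∑-zero (x ∷ xs) = ∑-zero xs

∑-+ : ∀ (xs : List A) f g → ∑[ x ∈ xs ] (f x + g x) ≡ ∑ xs f + ∑ xs g
∑-+ [] f g = refl
∑-+ (x ∷ xs) f g = trans (cong (f x + g x +_) (∑-+ xs f g)) (+-interchange (f x) (g x) _ _)

∑-*ˡ : ∀ (xs : List A) c f → ∑[ x ∈ xs ] (c * f x) ≡ c * ∑ xs f
∑-*ˡ [] c f = sym (*-zeroʳ c)
∑-*ˡ (x ∷ xs) c f = trans (cong (c * f x +_) (∑-*ˡ xs c f)) (sym (*-distribˡ-+ c (f x) _))

∑-*ʳ : ∀ (xs : List A) f c → ∑[ x ∈ xs ] (f x * c) ≡ ∑ xs f * c
∑-*ʳ [] f c = refl
∑-*ʳ (x ∷ xs) f c = trans (cong (f x * c +_) (∑-*ʳ xs f c)) (sym (*-distribʳ-+ c (f x) _))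

∑-swap : ∀ (xs : List A) (ys : List B) (f : A → B → ℕ) →
  ∑[ x ∈ xs ] ∑[ y ∈ ys ] f x y ≡ ∑[ y ∈ ys ] ∑[ x ∈ xs ] f x y
∑-swap [] ys f = sym (∑-zero ys)
∑-swap (x ∷ xs) ys f =
  trans (cong (∑ ys (f x) +_) (∑-swap xs ys f)) (sym (∑-+ ys (f x) (λ y → ∑[ x ∈ xs ] f x y)))

length≡∑1 : ∀ (xs : List A) → length xs ≡ ∑[ x ∈ xs ] 1
length≡∑1 [] = refl
length≡∑1 (x ∷ xs) = cong suc (length≡∑1 xs)

length-concatMap : ∀ (g : A → List B) xs → length (concatMap g xs) ≡ ∑[ x ∈ xs ] length (g x)
length-concatMap g [] = refl
length-concatMap g (x ∷ xs) =
  trans (length-++ (g x)) (cong (length (g x) +_) (length-concatMap g xs))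

length-filterᵇ : ∀ (p : A → Bool) xs → length (filterᵇ p xs) ≡ ∑[ x ∈ xs ] 𝟙 (p x)
length-filterᵇ p [] = refl
length-filterᵇ p (x ∷ xs) with p x
... | true = cong suc (length-filterᵇ p xs)
... | false = length-filterᵇ p xs

∑-filterᵇ-≤ : ∀ (p : A → Bool) xs f → ∑ (filterᵇ p xs) f ≤ ∑ xs f
∑-filterᵇ-≤ p [] f = z≤n
∑-filterᵇ-≤ p (x ∷ xs) f with p x
... | true = +-monoʳ-≤ (f x) (∑-filterᵇ-≤ p xs f)
... | false = ≤-trans (∑-filterᵇ-≤ p xs f) (m≤n+m _ (f x))

length-cartesianProduct : ∀ (xs : List A) (ys : List B) →
  length (cartesianProduct xs ys) ≡ length xs * length ys
length-cartesianProduct [] ys = refl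
length-cartesianProduct (x ∷ xs) ys = trans (length-++ (map (x ,_) ys))
  (cong₂ _+_ (length-map (x ,_) ys) (length-cartesianProduct xs ys))

quads : List A → List (A × A × A × A)
quads xs = cartesianProduct xs (cartesianProduct xs (cartesianProduct xs xs))

length-quads : ∀ (xs : List A) → length (quads xs) ≡ length xs ^ 4
length-quads xs = begin
  length (quads xs)
    ≡⟨ length-cartesianProduct xs _ ⟩
  n * length (cartesianProduct xs (cartesianProduct xs xs))
    ≡⟨ cong (n *_) (length-cartesianProduct xs _) ⟩
  n * (n * length (cartesianProduct xs xs))
    ≡⟨ cong (λ m → n * (n * m)) (length-cartesianProduct xs xs) ⟩
  n * (n * (n * n))
    ≡⟨ cong (λ m → n * (n * (n * m))) (*-identityʳ n) ⟨
  n ^ 4 ∎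
  where
  open ≡-Reasoning
  n = length xs

∈-quads : ∀ {xs : List A} {a b c d} → a ∈ xs → b ∈ xs → c ∈ xs → d ∈ xs →
  (a , b , c , d) ∈ quads xs
∈-quads a∈ b∈ c∈ d∈ = ∈-cartesianProduct⁺ a∈ (∈-cartesianProduct⁺ b∈ (∈-cartesianProduct⁺ c∈ d∈))

𝟙-∧ : ∀ a b → 𝟙 (a ∧ b) ≡ 𝟙 a * 𝟙 b
𝟙-∧ true b = sym (+-identityʳ (𝟙 b))
𝟙-∧ false b = refl

Any⇒1≤∑𝟙 : ∀ {p : A → Bool} {xs} → Any (T ∘ p) xs → 1 ≤ ∑[ x ∈ xs ] 𝟙 (p x)
Any⇒1≤∑𝟙 {p = p} {x ∷ xs} (here px) with p x
... | true = s≤s z≤n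
Any⇒1≤∑𝟙 {p = p} {x ∷ xs} (there pxs) = ≤-trans (Any⇒1≤∑𝟙 pxs) (m≤n+m _ (𝟙 (p x)))

1≤∑𝟙⇒Any : ∀ (p : A → Bool) xs → 1 ≤ ∑[ x ∈ xs ] 𝟙 (p x) → Any (T ∘ p) xs
1≤∑𝟙⇒Any p (x ∷ xs) pos with p x in px
... | true = here (Equivalence.from T-≡ px)
... | false = there (1≤∑𝟙⇒Any p xs pos)

covering⇒length-≤ : ∀ (r : A → B → Bool) (xs : List A) (zs : List B) →
  All (λ x → Any (λ z → T (r x z)) zs) xs →
  (∀ z → ∑[ x ∈ xs ] 𝟙 (r x z) ≤ 1) →
  length xs ≤ length zs
covering⇒length-≤ r xs zs covered unique = begin
  length xs                                  ≡⟨ length≡∑1 xs ⟩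
  ∑[ x ∈ xs ] 1                              ≤⟨ ∑-monoᴬ (All.map Any⇒1≤∑𝟙 covered) ⟩
  ∑[ x ∈ xs ] ∑[ z ∈ zs ] 𝟙 (r x z)          ≡⟨ ∑-swap xs zs (λ x z → 𝟙 (r x z)) ⟩
  ∑[ z ∈ zs ] ∑[ x ∈ xs ] 𝟙 (r x z)          ≤⟨ ∑-mono zs unique ⟩
  ∑[ z ∈ zs ] 1                              ≡⟨ length≡∑1 zs ⟨
  length zs                                  ∎
  where open ≤-Reasoning

==-refl : ∀ {k} (x : Point k) → (x == x) ≡ true
==-refl x = Equivalence.to T-≡ (fromWitness refl)

==-false : ∀ {k} {x y : Point k} → x ≢ y → (x == y) ≡ false
==-false x≢y = Equivalence.to T-not-≡ (fromWitnessFalse x≢y)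

==-sound : ∀ {k} {x y : Point k} → (x == y) ≡ true → x ≡ y
==-sound e = toWitness (Equivalence.from T-≡ e)

-- `does` of the decision on b ∷ x and b ∷ y reduces to the one on x and y; `isYes` does not.
==-∷ : ∀ {k} b (x y : Point k) → ((b ∷ x) == (b ∷ y)) ≡ (x == y)
==-∷ false x y = trans (isYes≗does _) (sym (isYes≗does _))
==-∷ true x y = trans (isYes≗does _) (sym (isYes≗does _))

count-allPoints : ∀ {k} (y : Point k) → ∑[ x ∈ allPoints k ] 𝟙 (x == y) ≡ 1
count-allPoints {zero} [] = refl
count-allPoints {suc k} (b ∷ y) = begin
  ∑ (map (false ∷_) (allPoints k) ++ map (true ∷_) (allPoints k)) (λ x → 𝟙 (x == (b ∷ y)))
    ≡⟨ ∑-++ (map (false ∷_) (allPoints k)) _ _ ⟩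
  ∑ (map (false ∷_) (allPoints k)) (λ x → 𝟙 (x == (b ∷ y)))
    + ∑ (map (true ∷_) (allPoints k)) (λ x → 𝟙 (x == (b ∷ y)))
    ≡⟨ cong₂ _+_ (∑-map (false ∷_) (allPoints k) _) (∑-map (true ∷_) (allPoints k) _) ⟩
  ∑[ x ∈ allPoints k ] 𝟙 ((false ∷ x) == (b ∷ y)) + ∑[ x ∈ allPoints k ] 𝟙 ((true ∷ x) == (b ∷ y))
    ≡⟨ halves b ⟩
  1 ∎
  where
  open ≡-Reasoning
  matching : ∀ c → ∑[ x ∈ allPoints k ] 𝟙 ((c ∷ x) == (c ∷ y)) ≡ 1
  matching c = trans (∑-cong (allPoints k) (λ x → cong 𝟙 (==-∷ c x y))) (count-allPoints y)
  halves : ∀ b → ∑[ x ∈ allPoints k ] 𝟙 ((false ∷ x) == (b ∷ y))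
               + ∑[ x ∈ allPoints k ] 𝟙 ((true ∷ x) == (b ∷ y)) ≡ 1
  halves false = cong₂ _+_ (matching false) (∑-zero (allPoints k))
  halves true = cong₂ _+_ (∑-zero (allPoints k)) (matching true)

∈-allPoints : ∀ {k} (x : Point k) → x ∈ allPoints k
∈-allPoints {k} x = Any.map (sym ∘ toWitness)
  (1≤∑𝟙⇒Any (_== x) (allPoints k) (≤-reflexive (sym (count-allPoints x))))

length-allPoints : ∀ k → length (allPoints k) ≡ 2 ^ k
length-allPoints zero = refl
length-allPoints (suc k) = begin
  length (map (false ∷_) (allPoints k) ++ map (true ∷_) (allPoints k))
    ≡⟨ length-++ (map (false ∷_) (allPoints k)) ⟩
  length (map (false ∷_) (allPoints k)) + length (map (true ∷_) (allPoints k))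
    ≡⟨ cong₂ _+_ (length-map _ (allPoints k)) (length-map _ (allPoints k)) ⟩
  length (allPoints k) + length (allPoints k)
    ≡⟨ cong (λ n → n + n) (length-allPoints k) ⟩
  2 ^ k + 2 ^ k
    ≡⟨ cong (2 ^ k +_) (+-identityʳ (2 ^ k)) ⟨
  2 ^ suc k ∎
  where open ≡-Reasoning

∑-δ : ∀ {k} (x : Point k) (p : Pred k) → ∑[ y ∈ allPoints k ] 𝟙 ((y == x) ∧ p y) ≡ 𝟙 (p x)
∑-δ {k} x p = begin
  ∑[ y ∈ allPoints k ] 𝟙 ((y == x) ∧ p y)   ≡⟨ ∑-cong (allPoints k) factor ⟩
  ∑[ y ∈ allPoints k ] (𝟙 (y == x) * 𝟙 (p x)) ≡⟨ ∑-*ʳ (allPoints k) _ (𝟙 (p x)) ⟩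
  ∑[ y ∈ allPoints k ] 𝟙 (y == x) * 𝟙 (p x)   ≡⟨ cong (_* 𝟙 (p x)) (count-allPoints x) ⟩
  1 * 𝟙 (p x)                                 ≡⟨ *-identityˡ _ ⟩
  𝟙 (p x)                                     ∎
  where
  open ≡-Reasoning
  factor : ∀ y → 𝟙 ((y == x) ∧ p y) ≡ 𝟙 (y == x) * 𝟙 (p x)
  factor y with y == x in e
  ... | true rewrite ==-sound e = sym (+-identityʳ _)
  ... | false = refl

⊕-assoc : ∀ {k} (x y z : Point k) → (x ⊕ y) ⊕ z ≡ x ⊕ (y ⊕ z)
⊕-assoc = zipWith-assoc xor-assoc

⊕-comm : ∀ {k} (x y : Point k) → x ⊕ y ≡ y ⊕ x
⊕-comm = zipWith-comm xor-comm

⊕-identityˡ : ∀ {k} (x : Point k) → zeroV ⊕ x ≡ x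
⊕-identityˡ = zipWith-identityˡ xor-identityˡ

⊕-identityʳ : ∀ {k} (x : Point k) → x ⊕ zeroV ≡ x
⊕-identityʳ = zipWith-identityʳ xor-identityʳ

⊕-self : ∀ {k} (x : Point k) → x ⊕ x ≡ zeroV
⊕-self [] = refl
⊕-self (b ∷ x) = cong₂ _∷_ (xor-same b) (⊕-self x)

⊕-involutiveˡ : ∀ {k} (x y : Point k) → x ⊕ (x ⊕ y) ≡ y
⊕-involutiveˡ x y = begin
  x ⊕ (x ⊕ y)   ≡⟨ ⊕-assoc x x y ⟨
  (x ⊕ x) ⊕ y   ≡⟨ cong (_⊕ y) (⊕-self x) ⟩
  zeroV ⊕ y     ≡⟨ ⊕-identityˡ y ⟩
  y             ∎
  where open ≡-Reasoning

⊕-cancelˡ : ∀ {k} (x : Point k) {y z} → x ⊕ y ≡ x ⊕ z → y ≡ z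
⊕-cancelˡ x {y} {z} e = trans (sym (⊕-involutiveˡ x y)) (trans (cong (x ⊕_) e) (⊕-involutiveˡ x z))

⊕-swapʳ : ∀ {k} (x y z : Point k) → (x ⊕ y) ⊕ z ≡ (x ⊕ z) ⊕ y
⊕-swapʳ x y z = begin
  (x ⊕ y) ⊕ z   ≡⟨ ⊕-assoc x y z ⟩
  x ⊕ (y ⊕ z)   ≡⟨ cong (x ⊕_) (⊕-comm y z) ⟩
  x ⊕ (z ⊕ y)   ≡⟨ ⊕-assoc x z y ⟨
  (x ⊕ z) ⊕ y   ∎
  where open ≡-Reasoning

⊕-identity-unique : ∀ {k} (x y : Point k) → x ≡ x ⊕ y → y ≡ zeroV
⊕-identity-unique x y e = ⊕-cancelˡ x (trans (sym e) (sym (⊕-identityʳ x)))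

infix 4 _≗ᵇ_

-- Pointwise equality, by recursion on k so that it computes along the enumeration allPreds.
_≗ᵇ_ : ∀ {k} → Pred k → Pred k → Bool
_≗ᵇ_ {zero} P Q = ⌊ P [] Bool.≟ Q [] ⌋
_≗ᵇ_ {suc k} P Q = (P ∘ (false ∷_) ≗ᵇ Q ∘ (false ∷_)) ∧ (P ∘ (true ∷_) ≗ᵇ Q ∘ (true ∷_))

≗ᵇ-sound : ∀ {k} {P Q : Pred k} → T (P ≗ᵇ Q) → P ≗ Q
≗ᵇ-sound {zero} e [] = toWitness e
≗ᵇ-sound {suc k} e (false ∷ x) = ≗ᵇ-sound (proj₁ (Equivalence.to T-∧ e)) x
≗ᵇ-sound {suc k} e (true ∷ x) = ≗ᵇ-sound (proj₂ (Equivalence.to T-∧ e)) x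

≗ᵇ-complete : ∀ {k} {P Q : Pred k} → P ≗ Q → T (P ≗ᵇ Q)
≗ᵇ-complete {zero} P≗Q = fromWitness (P≗Q [])
≗ᵇ-complete {suc k} P≗Q =
  Equivalence.from T-∧ (≗ᵇ-complete (P≗Q ∘ (false ∷_)) , ≗ᵇ-complete (P≗Q ∘ (true ∷_)))

count-allPreds : ∀ {k} (Q : Pred k) → ∑[ P ∈ allPreds k ] 𝟙 (P ≗ᵇ Q) ≡ 1
count-allPreds {zero} Q with Q []
... | false = refl
... | true = refl
count-allPreds {suc k} Q = begin
  ∑[ P ∈ allPreds (suc k) ] 𝟙 (P ≗ᵇ Q)
    ≡⟨ ∑-concatMap (λ p → map (combine p) (allPreds k)) (allPreds k) _ ⟩
  ∑[ p ∈ allPreds k ] ∑ (map (combine p) (allPreds k)) (λ P → 𝟙 (P ≗ᵇ Q))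
    ≡⟨ ∑-cong (allPreds k) (λ p → ∑-map (combine p) (allPreds k) _) ⟩
  ∑[ p ∈ allPreds k ] ∑[ q ∈ allPreds k ] 𝟙 ((p ≗ᵇ Q₀) ∧ (q ≗ᵇ Q₁))
    ≡⟨ ∑-cong (allPreds k) (λ p → ∑-cong (allPreds k) (λ q → 𝟙-∧ (p ≗ᵇ Q₀) (q ≗ᵇ Q₁))) ⟩
  ∑[ p ∈ allPreds k ] ∑[ q ∈ allPreds k ] (𝟙 (p ≗ᵇ Q₀) * 𝟙 (q ≗ᵇ Q₁))
    ≡⟨ ∑-cong (allPreds k) (λ p → ∑-*ˡ (allPreds k) (𝟙 (p ≗ᵇ Q₀)) _) ⟩
  ∑[ p ∈ allPreds k ] (𝟙 (p ≗ᵇ Q₀) * ∑[ q ∈ allPreds k ] 𝟙 (q ≗ᵇ Q₁))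
    ≡⟨ ∑-cong (allPreds k) (λ p → cong (𝟙 (p ≗ᵇ Q₀) *_) (count-allPreds Q₁)) ⟩
  ∑[ p ∈ allPreds k ] (𝟙 (p ≗ᵇ Q₀) * 1)
    ≡⟨ ∑-cong (allPreds k) (λ p → *-identityʳ _) ⟩
  ∑[ p ∈ allPreds k ] 𝟙 (p ≗ᵇ Q₀)
    ≡⟨ count-allPreds Q₀ ⟩
  1 ∎
  where
  open ≡-Reasoning
  Q₀ Q₁ : Pred k
  Q₀ = Q ∘ (false ∷_)
  Q₁ = Q ∘ (true ∷_)

∈≗-allPreds : ∀ {k} (Q : Pred k) → Any (_≗ Q) (allPreds k)
∈≗-allPreds {k} Q = Any.map ≗ᵇ-sound
  (1≤∑𝟙⇒Any (_≗ᵇ Q) (allPreds k) (≤-reflexive (sym (count-allPreds Q))))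

filterᵇ-cong : ∀ {p q : A → Bool} → p ≗ q → ∀ xs → filterᵇ p xs ≡ filterᵇ q xs
filterᵇ-cong {p = p} {q} p≗q =
  filter-≐ (T? ∘ p) (T? ∘ q) ((λ {x} → subst T (p≗q x)) , (λ {x} → subst T (sym (p≗q x))))

weight-cong : ∀ {k} {P Q : Pred k} → P ≗ Q → weight P ≡ weight Q
weight-cong {k} P≗Q = cong length (filterᵇ-cong P≗Q (allPoints k))

-- Moving points in and out of P⁻¹(1)

-- y == x is ⌊ y ≟ x ⌋, so splitting on y ≟ x evaluates the updates below.
_≟_ : ∀ {k} → DecidableEquality (Point k)
_≟_ = ≡-dec Bool._≟_

_[_≔_] : ∀ {k} → Pred k → Point k → Bool → Pred k
(P [ x ≔ b ]) y = if y == x then b else P y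

update-≡ : ∀ {k} (P : Pred k) x b → (P [ x ≔ b ]) x ≡ b
update-≡ P x b rewrite ==-refl x = refl

update-≢ : ∀ {k} (P : Pred k) {x y} b → y ≢ x → (P [ x ≔ b ]) y ≡ P y
update-≢ P b y≢x rewrite ==-false y≢x = refl

weight-update : ∀ {k} (P : Pred k) x b → weight (P [ x ≔ b ]) + 𝟙 (P x) ≡ weight P + 𝟙 b
weight-update {k} P x b = begin
  weight (P [ x ≔ b ]) + 𝟙 (P x)
    ≡⟨ cong₂ _+_ (length-filterᵇ (P [ x ≔ b ]) (allPoints k)) (sym (∑-δ x P)) ⟩
  ∑[ y ∈ allPoints k ] 𝟙 ((P [ x ≔ b ]) y) + ∑[ y ∈ allPoints k ] 𝟙 ((y == x) ∧ P y)
    ≡⟨ ∑-+ (allPoints k) _ _ ⟨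
  ∑[ y ∈ allPoints k ] (𝟙 ((P [ x ≔ b ]) y) + 𝟙 ((y == x) ∧ P y))
    ≡⟨ ∑-cong (allPoints k) balance ⟩
  ∑[ y ∈ allPoints k ] (𝟙 (P y) + 𝟙 ((y == x) ∧ b))
    ≡⟨ ∑-+ (allPoints k) _ _ ⟩
  ∑[ y ∈ allPoints k ] 𝟙 (P y) + ∑[ y ∈ allPoints k ] 𝟙 ((y == x) ∧ b)
    ≡⟨ cong₂ _+_ (sym (length-filterᵇ P (allPoints k))) (∑-δ x (λ _ → b)) ⟩
  weight P + 𝟙 b ∎
  where
  open ≡-Reasoning
  balance : ∀ y → 𝟙 ((P [ x ≔ b ]) y) + 𝟙 ((y == x) ∧ P y) ≡ 𝟙 (P y) + 𝟙 ((y == x) ∧ b)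
  balance y with y == x
  ... | true = +-comm (𝟙 b) (𝟙 (P y))
  ... | false = refl

≢-by-value : ∀ {k} {P : Pred k} {x s} → P x ≡ false → P s ≡ true → x ≢ s
≢-by-value Px Ps refl with () ← trans (sym Px) Ps

exchange : ∀ {k} → Pred k → Point k → Point k → Pred k
exchange P x s = (P [ s ≔ false ]) [ x ≔ true ]

exchange-admits : ∀ {k} (P : Pred k) x s → exchange P x s x ≡ true
exchange-admits P x s = update-≡ (P [ s ≔ false ]) x true

exchange-evicts : ∀ {k} (P : Pred k) {x s} → x ≢ s → exchange P x s s ≡ false
exchange-evicts P {x} {s} x≢s =
  trans (update-≢ (P [ s ≔ false ]) {x} true (x≢s ∘ sym)) (update-≡ P s false)

exchange-keeps : ∀ {k} (P : Pred k) x {s y} → y ≢ s → P y ≡ true → exchange P x s y ≡ true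
exchange-keeps P x {s} {y} y≢s Py with y ≟ x
... | yes refl = refl
... | no _ = trans (update-≢ P false y≢s) Py

exchange-involutive : ∀ {k} {P : Pred k} {x s} → P x ≡ false → P s ≡ true →
  exchange (exchange P x s) s x ≗ P
exchange-involutive {x = x} {s} Px Ps y with y ≟ s
... | yes refl = sym Ps
... | no _ with y ≟ x
...   | yes refl = sym Px
...   | no _ = refl

weight-exchange : ∀ {k} {P : Pred k} {x s} → P x ≡ false → P s ≡ true →
  weight (exchange P x s) ≡ weight P
weight-exchange {P = P} {x} {s} Px Ps = begin
  weight (exchange P x s)                 ≡⟨ +-identityʳ _ ⟨
  weight (exchange P x s) + 0             ≡⟨ cong (λ b → weight (exchange P x s) + 𝟙 b) P′x ⟨
  weight (exchange P x s) + 𝟙 (P′ x)      ≡⟨ weight-update P′ x true ⟩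
  weight P′ + 1                           ≡⟨ cong (λ b → weight P′ + 𝟙 b) Ps ⟨
  weight P′ + 𝟙 (P s)                     ≡⟨ weight-update P s false ⟩
  weight P + 0                            ≡⟨ +-identityʳ _ ⟩
  weight P                                ∎
  where
  open ≡-Reasoning
  P′ = P [ s ≔ false ]
  P′x : P′ x ≡ false
  P′x = trans (update-≢ P false (≢-by-value Px Ps)) Px

admit : ∀ {k} → Pred k → Point k → Point k → Pred k
admit P y z = if P y then P else exchange P y z

admit-present : ∀ {k} {P : Pred k} {y z} → P y ≡ true → admit P y z ≡ P
admit-present Py rewrite Py = refl

admit-absent : ∀ {k} {P : Pred k} {y z} → P y ≡ false → admit P y z ≡ exchange P y z
admit-absent Py rewrite Py = refl

admit-cong : ∀ {k} {P Q : Pred k} y z → P ≗ Q → admit P y z ≗ admit Q y z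
admit-cong {P = P} {Q} y z P≗Q w rewrite P≗Q y with Q y
... | true = P≗Q w
... | false = cong (λ b → if w == y then true else (if w == z then false else b)) (P≗Q w)

admit-admits : ∀ {k} (P : Pred k) y z → admit P y z y ≡ true
admit-admits P y z with P y in Py
... | true = Py
... | false = exchange-admits P y z

admit-keeps : ∀ {k} (P : Pred k) y {z w} → w ≢ z → P w ≡ true → admit P y z w ≡ true
admit-keeps P y w≢z Pw with P y
... | true = Pw
... | false = exchange-keeps P y w≢z Pw

weight-admit : ∀ {k} {P : Pred k} y {z} → P z ≡ true → weight (admit P y z) ≡ weight P
weight-admit {P = P} y {z} Pz with P y in Py
... | true = refl
... | false = weight-exchange {P = P} {y} {z} Py Pz

admit-involutive : ∀ {k} {P : Pred k} y {z} → P z ≡ true → admit (admit P y z) z y ≗ P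
admit-involutive {P = P} y {z} Pz w with P y in Py
... | true = cong-app (admit-present {P = P} {z} {y} Pz) w
... | false = trans (cong-app (admit-absent {P = exchange P y z} {z} {y} z-evicted) w)
                    (exchange-involutive {P = P} Py Pz w)
  where z-evicted = exchange-evicts P {y} {z} (≢-by-value {P = P} Py Pz)

-- Affine planes

record AffinePlaneIn {k} (P : Pred k) : Set where
  field
    a u v : Point k
    u≢0 : u ≢ zeroV
    v≢0 : v ≢ zeroV
    u≢v : u ≢ v
    Pa : P a ≡ true
    Pa+u : P (a ⊕ u) ≡ true
    Pa+v : P (a ⊕ v) ≡ true
    Pa+u+v : P ((a ⊕ u) ⊕ v) ≡ true

  d : Point k
  d = (a ⊕ u) ⊕ v

  a≢d : a ≢ d
  a≢d e = u≢v (sym (⊕-cancelˡ u (trans u+v≡0 (sym (⊕-self u)))))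
    where u+v≡0 = ⊕-identity-unique a (u ⊕ v) (trans e (⊕-assoc a u v))

  a+u≢d : a ⊕ u ≢ d
  a+u≢d e = v≢0 (⊕-identity-unique (a ⊕ u) v e)

  a+v≢d : a ⊕ v ≢ d
  a+v≢d e = u≢0 (⊕-identity-unique (a ⊕ v) u (trans e (⊕-swapʳ a u v)))

  fourth-vertex : (a ⊕ (a ⊕ u)) ⊕ (a ⊕ v) ≡ d
  fourth-vertex = begin
    (a ⊕ (a ⊕ u)) ⊕ (a ⊕ v)   ≡⟨ cong (_⊕ (a ⊕ v)) (⊕-involutiveˡ a u) ⟩
    u ⊕ (a ⊕ v)               ≡⟨ ⊕-assoc u a v ⟨
    (u ⊕ a) ⊕ v               ≡⟨ cong (_⊕ v) (⊕-comm u a) ⟩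
    d                         ∎
    where open ≡-Reasoning

affinePlane : ∀ {k} {P : Pred k} → T (containsAffinePlane P) → AffinePlaneIn P
affinePlane {k} h =
  let a , h₁ = Any.satisfied (any⁻ _ (allPoints k) h)
      u , h₂ = Any.satisfied (any⁻ _ (allPoints k) h₁)
      v , h₃ = Any.satisfied (any⁻ _ (allPoints k) h₂)
      u≢0 , h₄ = ∧⁻ h₃
      v≢0 , h₅ = ∧⁻ h₄
      u≢v , h₆ = ∧⁻ h₅
      Pa , h₇ = ∧⁻ h₆
      Pa+u , h₈ = ∧⁻ h₇
      Pa+v , Pa+u+v = ∧⁻ h₈
  in record
    { a = a ; u = u ; v = v
    ; u≢0 = ≢ u≢0 ; v≢0 = ≢ v≢0 ; u≢v = ≢ u≢v
    ; Pa = ≡true Pa ; Pa+u = ≡true Pa+u ; Pa+v = ≡true Pa+v ; Pa+u+v = ≡true Pa+u+v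
    }
  where
  ∧⁻ : ∀ {b c} → T (b ∧ c) → T b × T c
  ∧⁻ = Equivalence.to T-∧
  ≡true : ∀ {b} → T b → b ≡ true
  ≡true = Equivalence.to T-≡
  ≢ : ∀ {x y : Point k} → T (not (x == y)) → x ≢ y
  ≢ = toWitnessFalse

-- The encoding

∈-support : ∀ {k} {P : Pred k} {x} → P x ≡ true → x ∈ filterᵇ P (allPoints k)
∈-support {x = x} Px = ∈-filter⁺ (T? ∘ _) (∈-allPoints x) (Equivalence.from T-≡ Px)

Quad : ℕ → Set
Quad k = Point k × Point k × Point k × Point k

decode : ∀ {k} → Pred k → Quad k → Pred k × Point k
decode Q (a , b , c , x) = admit Q ((a ⊕ b) ⊕ c) x , x

decoded : (k t : ℕ) → List (Pred k × Point k)
decoded k t = concatMap (λ Q → map (decode Q) (quads (filterᵇ Q (allPoints k)))) (predsOfWeight k t)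

badPairs : (k t : ℕ) → List (Pred k × Point k)
badPairs k t = cartesianProduct (badPreds k t) (allPoints k)

infix 4 _≈ᵇ_

_≈ᵇ_ : ∀ {k} → Pred k × Point k → Pred k × Point k → Bool
(P , x) ≈ᵇ (Q , y) = (x == y) ∧ (P ≗ᵇ Q)

weight-predsOfWeight : ∀ k t → All (λ Q → weight Q ≡ t) (predsOfWeight k t)
weight-predsOfWeight k t =
  All.map toWitness (all-filter (T? ∘ λ Q → ⌊ weight Q ℕ.≟ t ⌋) (allPreds k))

∈-decoded : ∀ {k t} {Q : Pred k} {q} → Q ∈ allPreds k → weight Q ≡ t →
  q ∈ quads (filterᵇ Q (allPoints k)) → decode Q q ∈ decoded k t
∈-decoded {Q = Q} Q∈ wQ q∈ =
  ∈-concatMap⁺ _ (lose (∈-filter⁺ (T? ∘ _) Q∈ (fromWitness wQ)) (∈-map⁺ (decode Q) q∈))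

length-decoded : ∀ k t → length (decoded k t) ≡ length (predsOfWeight k t) * t ^ 4
length-decoded k t = begin
  length (decoded k t)
    ≡⟨ length-concatMap _ (predsOfWeight k t) ⟩
  ∑[ Q ∈ predsOfWeight k t ] length (map (decode Q) (quads (filterᵇ Q (allPoints k))))
    ≡⟨ ∑-congᴬ (All.map length-part (weight-predsOfWeight k t)) ⟩
  ∑[ Q ∈ predsOfWeight k t ] (t ^ 4)
    ≡⟨ ∑-const (predsOfWeight k t) (t ^ 4) ⟩
  length (predsOfWeight k t) * t ^ 4 ∎
  where
  open ≡-Reasoning
  length-part : ∀ {Q} → weight Q ≡ t →
    length (map (decode Q) (quads (filterᵇ Q (allPoints k)))) ≡ t ^ 4
  length-part {Q} wQ = trans (length-map (decode Q) (quads support))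
    (trans (length-quads support) (cong (_^ 4) wQ))
    where support = filterᵇ Q (allPoints k)

badPair-covered : ∀ {k t} {P : Pred k} → T (containsAffinePlane P) → weight P ≡ t → ∀ x →
  Any (λ z → T ((P , x) ≈ᵇ z)) (decoded k t)
badPair-covered {k} {t} {P} P-bad wP x =
  let Q′ , Q′∈ , Q′≗Q = find (∈≗-allPreds Q)
  in lose (∈-decoded Q′∈ (trans (weight-cong Q′≗Q) wQ) (vertices∈ Q′≗Q)) (decodes-to-P Q′≗Q)
  where
  open AffinePlaneIn (affinePlane {P = P} P-bad)
  Q : Pred k
  Q = admit P x d
  wQ : weight Q ≡ t
  wQ = trans (weight-admit {P = P} x Pa+u+v) wP
  vertices∈ : ∀ {Q′} → Q′ ≗ Q → (a , a ⊕ u , a ⊕ v , x) ∈ quads (filterᵇ Q′ (allPoints k))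
  vertices∈ Q′≗Q = ∈-quads (kept a≢d Pa) (kept a+u≢d Pa+u) (kept a+v≢d Pa+v)
                           (∈-support (trans (Q′≗Q x) (admit-admits P x d)))
    where
    kept : ∀ {y} → y ≢ d → P y ≡ true → y ∈ filterᵇ _ (allPoints k)
    kept y≢d Py = ∈-support (trans (Q′≗Q _) (admit-keeps P x y≢d Py))
  decodes-to-P : ∀ {Q′} → Q′ ≗ Q → T ((P , x) ≈ᵇ decode Q′ (a , a ⊕ u , a ⊕ v , x))
  decodes-to-P {Q′} Q′≗Q = Equivalence.from T-∧ (fromWitness refl , ≗ᵇ-complete (sym ∘ restores))
    where
    restores : admit Q′ ((a ⊕ (a ⊕ u)) ⊕ (a ⊕ v)) x ≗ P
    restores w rewrite fourth-vertex =
      trans (admit-cong d x Q′≗Q w) (admit-involutive {P = P} x Pa+u+v w)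

badPairs-covered : ∀ k t → All (λ p → Any (λ z → T (p ≈ᵇ z)) (decoded k t)) (badPairs k t)
badPairs-covered k t = All.tabulate λ {(P , x)} p∈ →
  let P∈B , _ = ∈-cartesianProduct⁻ (badPreds k t) (allPoints k) p∈
      P∈W , P-bad = ∈-filter⁻ (T? ∘ containsAffinePlane) P∈B
  in badPair-covered {P = P} P-bad (All.lookup (weight-predsOfWeight k t) P∈W) x

badPairs-matched-once : ∀ k t (z : Pred k × Point k) → ∑[ p ∈ badPairs k t ] 𝟙 (p ≈ᵇ z) ≤ 1
badPairs-matched-once k t (Q , y) = begin
  ∑[ p ∈ badPairs k t ] 𝟙 (p ≈ᵇ (Q , y))
    ≡⟨ ∑-cartesianProduct (badPreds k t) (allPoints k) _ ⟩
  ∑[ P ∈ badPreds k t ] ∑[ x ∈ allPoints k ] 𝟙 ((x == y) ∧ (P ≗ᵇ Q))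
    ≡⟨ ∑-cong (badPreds k t) (λ P → ∑-δ y (λ _ → P ≗ᵇ Q)) ⟩
  ∑[ P ∈ badPreds k t ] 𝟙 (P ≗ᵇ Q)
    ≤⟨ ∑-filterᵇ-≤ containsAffinePlane (predsOfWeight k t) _ ⟩
  ∑[ P ∈ predsOfWeight k t ] 𝟙 (P ≗ᵇ Q)
    ≤⟨ ∑-filterᵇ-≤ _ (allPreds k) _ ⟩
  ∑[ P ∈ allPreds k ] 𝟙 (P ≗ᵇ Q)
    ≡⟨ count-allPreds Q ⟩
  1 ∎
  where open ≤-Reasoning

mainTheorem5 : (k t : ℕ) →
    length (badPreds k t) * 2 ^ k ≤ t ^ 4 * length (predsOfWeight k t)
mainTheorem5 k t = begin
  length (badPreds k t) * 2 ^ k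
    ≡⟨ cong (length (badPreds k t) *_) (length-allPoints k) ⟨
  length (badPreds k t) * length (allPoints k)
    ≡⟨ length-cartesianProduct (badPreds k t) (allPoints k) ⟨
  length (badPairs k t)
    ≤⟨ covering⇒length-≤ _≈ᵇ_ (badPairs k t) (decoded k t)
         (badPairs-covered k t) (badPairs-matched-once k t) ⟩
  length (decoded k t)
    ≡⟨ length-decoded k t ⟩
  length (predsOfWeight k t) * t ^ 4
    ≡⟨ *-comm _ (t ^ 4) ⟩
  t ^ 4 * length (predsOfWeight k t) ∎
  where open ≤-Reasoning
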